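{- Let $N=p_1p_2\cdots p_m$ be a squarefree composite positive integer with primes $p_1<p_2<\dots<p_m$ ($m\ge 2$). For $k\in\mathbb{Z}\setminus\{ -1\}$ and a prime $p\mid N$ put $M(k,p)=\frac{N+kp}{k+1}$. Then: (1) the sequences $\big(M(2j,p_{2j})\big)_j$ (over integers $j$ with $1\le 2j\le m$) and $\big(M(2j+1,p_{2j+1})\big)_j$ (over integers $j$ with $1\le 2j+1\le m$) are decreasing; (2) the sequences $\big(M(2j-m-3,p_{2j})\big)_j$ (over integers $j$ with $1\le 2j\le m$) and $\big(M(2j-m-2,p_{2j+1})\big)_j$ (over integers $j$ with $1\le 2j+1\le m$) are decreasing. -}

module Defs where

open import Data.Nat as ℕ using (ℕ; zero; suc)
open import Data.Integer as ℤ using (ℤ; +_; -[1+_]; +[1+_])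
open import Data.Rational using (ℚ; _/_)

prodPrimes : (ℕ → ℕ) → ℕ → ℕ
prodPrimes p zero    = 1
prodPrimes p (suc m) = prodPrimes p m ℕ.* p (suc m)

-- M N k p = (N + k p) / (k + 1) as a rational number.
-- The case k = -1 (denominator 0) is excluded in the paper; here it is
-- given the junk value 0 and never used by the statement.
M : ℕ → ℤ → ℕ → ℚ
M N k p with k ℤ.+ + 1
... | + zero    = + 0 / 1
... | +[1+ d ]  = (+ N ℤ.+ k ℤ.* + p) / suc d
... | -[1+ d ]  = (ℤ.- (+ N ℤ.+ k ℤ.* + p)) / suc d

DecreasingOn : (ℕ → Set) → (ℕ → ℚ) → Set
DecreasingOn R a = ∀ i j → R i → R j → i ℕ.< j → a j Data.Rational.< a i
  where import Data.Rational

{-# OPTIONS --safe #-}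

-- All four sequences compare M at indices 1 ≤ t₁ with t₁ + 2 ≤ t₂ ≤ m.  For k = t,
-- clearing the denominators t + 1 turns M(t₂, p_t₂) < M(t₁, p_t₁) into an inequality
-- in which a gain of N·(t₂ − t₁) ≥ 2N has to beat t₂·(t₁ + 1)·p_t₂.  It does, since
-- N ≥ p_t₂ · m! (every other prime p_i exceeds i) and t₂·(t₁ + 1) ≤ m(m + 1) ≤ 2·m!
-- for m ≥ 3.  For k = t − m − 3 the denominators become |k + 1| = m + 2 − t and the
-- same estimate applies with their roles exchanged.

module Submission where

open import Defs
open import Data.Nat as ℕ using (ℕ; zero; suc; _≤_; _<_; _*_; _+_; _∸_; z≤n; s≤s; _!)
open import Data.Nat.Properties
open import Algebra.Properties.CommutativeSemigroup *-commutativeSemigroup using (x∙yz≈y∙xz)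
open import Data.Nat.Primality using (Prime; prime⇒nonTrivial)
open import Data.Nat.Tactic.RingSolver using (solve)
open import Data.Integer as ℤ using (ℤ; +_; -[1+_])
import Data.Integer.Properties as ℤP
import Data.Integer.Tactic.RingSolver as ℤRing
open import Data.Rational as ℚ using (ℚ; _/_; fromℚᵘ)
import Data.Rational.Properties as ℚP
import Data.Rational.Unnormalised as ℚᵘ
import Data.Rational.Unnormalised.Properties as ℚᵘP
open import Data.List using ([]; _∷_)
open import Data.Product using (_×_; _,_)
open import Relation.Binary.PropositionalEquality
open import Relation.Nullary using (yes; no)

increasing⇒i<p : ∀ {m} {p : ℕ → ℕ} → (∀ i → 1 ≤ i → i ≤ m → 2 ≤ p i)
  → (∀ i i′ → 1 ≤ i → i < i′ → i′ ≤ m → p i < p i′)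
  → ∀ i → 1 ≤ i → i ≤ m → i < p i
increasing⇒i<p p≥2 _   1             1≤i 1≤m = p≥2 1 1≤i 1≤m
increasing⇒i<p p≥2 inc (suc (suc i)) _   i≤m =
  <-≤-trans (s≤s (increasing⇒i<p p≥2 inc (suc i) (s≤s z≤n) (≤-trans (n≤1+n _) i≤m)))
            (inc (suc i) (suc (suc i)) (s≤s z≤n) ≤-refl i≤m)

module _ {m : ℕ} {p : ℕ → ℕ} (i<p : ∀ i → 1 ≤ i → i ≤ m → i < p i) where

  suc!≤prodPrimes : ∀ {k} → k ≤ m → suc k ! ≤ prodPrimes p k
  suc!≤prodPrimes {zero}  _   = ≤-refl
  suc!≤prodPrimes {suc k} k<m = begin
    suc (suc k) !          ≡⟨ *-comm (suc (suc k)) (suc k !) ⟩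
    suc k ! * suc (suc k)  ≤⟨ *-mono-≤ (suc!≤prodPrimes (≤-trans (n≤1+n _) k<m)) (i<p (suc k) (s≤s z≤n) k<m) ⟩
    prodPrimes p (suc k)   ∎
    where open ≤-Reasoning

  p*!≤prodPrimes : ∀ {k t} → 1 ≤ t → t ≤ k → k ≤ m → p t * k ! ≤ prodPrimes p k
  p*!≤prodPrimes {zero}  (s≤s _) ()
  p*!≤prodPrimes {suc k} {t} 1≤t t≤k k<m with t ℕ.≟ suc k
  ... | yes refl = begin
    p (suc k) * suc k !  ≡⟨ *-comm (p (suc k)) (suc k !) ⟩
    suc k ! * p (suc k)  ≤⟨ *-monoˡ-≤ (p (suc k)) (suc!≤prodPrimes (≤-trans (n≤1+n _) k<m)) ⟩
    prodPrimes p (suc k) ∎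
    where open ≤-Reasoning
  ... | no t≢k = begin
    p t * suc k !        ≡⟨ cong (p t *_) (*-comm (suc k) (k !)) ⟩
    p t * (k ! * suc k)  ≡⟨ *-assoc (p t) (k !) (suc k) ⟨
    p t * k ! * suc k    ≤⟨ *-mono-≤ (p*!≤prodPrimes 1≤t (ℕ.s≤s⁻¹ (≤∧≢⇒< t≤k t≢k)) (≤-trans (n≤1+n _) k<m))
                                     (≤-trans (n≤1+n _) (i<p (suc k) (s≤s z≤n) k<m)) ⟩
    prodPrimes p (suc k) ∎
    where open ≤-Reasoning

n*suc[n]≤2*n! : ∀ n → 3 ≤ n → n * suc n ≤ 2 * n !
n*suc[n]≤2*n! 1 (s≤s ())
n*suc[n]≤2*n! 2 (s≤s (s≤s ()))
n*suc[n]≤2*n! n@(suc (suc (suc k))) _ = begin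
  n * suc n               ≤⟨ *-monoʳ-≤ n suc[n]≤2*[n-1]! ⟩
  n * (2 * suc (suc k) !) ≡⟨ x∙yz≈y∙xz n 2 [n-1]! ⟩
  2 * n !                 ∎
  where
  open ≤-Reasoning
  [n-1]! : ℕ
  [n-1]! = suc (suc k) !
  n-1≤[n-1]! : suc (suc k) ≤ [n-1]!
  n-1≤[n-1]! = m≤m*n (suc (suc k)) (suc k !) {{suc k !≢0}}
  suc[n]≤2*[n-1]! : suc n ≤ 2 * [n-1]!
  suc[n]≤2*[n-1]! = begin
    suc n               ≡⟨ +-comm 2 (suc (suc k)) ⟩
    suc (suc k) + 2     ≤⟨ +-mono-≤ n-1≤[n-1]! (≤-trans (s≤s (s≤s z≤n)) n-1≤[n-1]!) ⟩
    [n-1]! + [n-1]!     ≡⟨ cong (λ x → [n-1]! + x) (+-identityʳ [n-1]!) ⟨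
    2 * [n-1]!          ∎

cross-<-pos : ∀ N {t₁ t₂ q₁ q₂} → 0 < t₁ → 0 < q₁ → 2 + t₁ ≤ t₂ → t₂ * suc t₁ * q₂ ≤ 2 * N
  → (N + t₂ * q₂) * suc t₁ < (N + t₁ * q₁) * suc t₂
cross-<-pos N {t₁} {t₂} {q₁} {q₂} t₁>0 q₁>0 gap bound = begin-strict
  (N + t₂ * q₂) * suc t₁          ≡⟨ solve (N ∷ t₁ ∷ t₂ ∷ q₂ ∷ []) ⟩
  N * suc t₁ + t₂ * suc t₁ * q₂   ≤⟨ +-monoʳ-≤ (N * suc t₁) bound ⟩
  N * suc t₁ + 2 * N              ≡⟨ solve (N ∷ t₁ ∷ []) ⟩
  N * (2 + suc t₁)                ≤⟨ *-monoʳ-≤ N (s≤s gap) ⟩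
  N * suc t₂                      <⟨ m<m+n (N * suc t₂) (*-mono-≤ (*-mono-≤ t₁>0 q₁>0) (s≤s z≤n)) ⟩
  N * suc t₂ + t₁ * q₁ * suc t₂   ≡⟨ solve (N ∷ t₁ ∷ t₂ ∷ q₁ ∷ []) ⟩
  (N + t₁ * q₁) * suc t₂          ∎
  where open ≤-Reasoning

cross-<-neg : ∀ N {c₁ c₂ q₁ q₂} → 0 < q₁ → 2 + c₂ ≤ c₁ → (2 + c₂) * suc c₁ * q₂ ≤ 2 * N
  → (2 + c₂) * q₂ * suc c₁ + N * suc c₂ < (2 + c₁) * q₁ * suc c₂ + N * suc c₁
cross-<-neg N {c₁} {c₂} {q₁} {q₂} q₁>0 gap bound = begin-strict
  (2 + c₂) * q₂ * suc c₁ + N * suc c₂  ≡⟨ solve (N ∷ c₁ ∷ c₂ ∷ q₂ ∷ []) ⟩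
  (2 + c₂) * suc c₁ * q₂ + N * suc c₂  ≤⟨ +-monoˡ-≤ (N * suc c₂) bound ⟩
  2 * N + N * suc c₂                   ≡⟨ solve (N ∷ c₂ ∷ []) ⟩
  N * (2 + suc c₂)                     ≤⟨ *-monoʳ-≤ N (s≤s gap) ⟩
  N * suc c₁                           <⟨ m<n+m (N * suc c₁) (*-mono-≤ (*-mono-≤ (s≤s (z≤n {suc c₁})) q₁>0) (s≤s z≤n)) ⟩
  (2 + c₁) * q₁ * suc c₂ + N * suc c₁  ∎
  where open ≤-Reasoning

fromℚᵘ-mono-< : ∀ {p q} → p ℚᵘ.< q → fromℚᵘ p ℚ.< fromℚᵘ q
fromℚᵘ-mono-< {p} {q} p<q = ℚP.toℚᵘ-cancel-<
  (ℚᵘP.<-respʳ-≃ (ℚᵘP.≃-sym (ℚP.toℚᵘ-fromℚᵘ q))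
  (ℚᵘP.<-respˡ-≃ (ℚᵘP.≃-sym (ℚP.toℚᵘ-fromℚᵘ p)) p<q))

/-cross-< : ∀ {n₁ n₂ : ℤ} {d₁ d₂} → n₁ ℤ.* + suc d₂ ℤ.< n₂ ℤ.* + suc d₁ → n₁ / suc d₁ ℚ.< n₂ / suc d₂
/-cross-< {n₁} {n₂} {d₁} {d₂} n₁d₂<n₂d₁ =
  fromℚᵘ-mono-< {ℚᵘ.mkℚᵘ n₁ d₁} {ℚᵘ.mkℚᵘ n₂ d₂} (ℚᵘ.*<* n₁d₂<n₂d₁)

[x-n]*z<[y-n]*w : ∀ {x y n z w : ℤ} → x ℤ.* z ℤ.+ n ℤ.* w ℤ.< y ℤ.* w ℤ.+ n ℤ.* z
  → (x ℤ.- n) ℤ.* z ℤ.< (y ℤ.- n) ℤ.* w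
[x-n]*z<[y-n]*w {x} {y} {n} {z} {w} h = begin-strict
  (x ℤ.- n) ℤ.* z                                ≡⟨ ℤRing.solve (x ∷ n ∷ z ∷ w ∷ []) ⟩
  x ℤ.* z ℤ.+ n ℤ.* w ℤ.- (n ℤ.* z ℤ.+ n ℤ.* w)  <⟨ ℤP.+-monoˡ-< (ℤ.- (n ℤ.* z ℤ.+ n ℤ.* w)) h ⟩
  y ℤ.* w ℤ.+ n ℤ.* z ℤ.- (n ℤ.* z ℤ.+ n ℤ.* w)  ≡⟨ ℤRing.solve (y ∷ n ∷ z ∷ w ∷ []) ⟩
  (y ℤ.- n) ℤ.* w                                ∎
  where open ℤP.≤-Reasoning

M-pos : ∀ N t q → M N (+ t) q ≡ + (N + t * q) / suc t
M-pos N t q rewrite +-comm t 1 | sym (ℤP.pos-* t q) = refl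

M-neg : ∀ N c q → M N -[1+ suc c ] q ≡ (+ ((2 + c) * q) ℤ.- + N) / suc c
M-neg N c q = cong (λ n → n / suc c)
  (trans (-[n-a*b]≡a*b-n (+ N) (+ (2 + c)) (+ q)) (cong (ℤ._- + N) (sym (ℤP.pos-* (2 + c) q))))
  where
  -[n-a*b]≡a*b-n : ∀ n a b → ℤ.- (n ℤ.+ ℤ.- a ℤ.* b) ≡ a ℤ.* b ℤ.- n
  -[n-a*b]≡a*b-n n a b = ℤRing.solve (n ∷ a ∷ b ∷ [])

M-pos-< : ∀ {N t₁ t₂ q₁ q₂} → (N + t₂ * q₂) * suc t₁ < (N + t₁ * q₁) * suc t₂
  → M N (+ t₂) q₂ ℚ.< M N (+ t₁) q₁
M-pos-< {N} {t₁} {t₂} {q₁} {q₂} h rewrite M-pos N t₁ q₁ | M-pos N t₂ q₂ =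
  /-cross-< {+ (N + t₂ * q₂)} {+ (N + t₁ * q₁)}
    (subst₂ ℤ._<_ (ℤP.pos-* (N + t₂ * q₂) (suc t₁)) (ℤP.pos-* (N + t₁ * q₁) (suc t₂)) (ℤ.+<+ h))

M-neg-< : ∀ {N c₁ c₂ q₁ q₂} → (2 + c₂) * q₂ * suc c₁ + N * suc c₂ < (2 + c₁) * q₁ * suc c₂ + N * suc c₁
  → M N -[1+ suc c₂ ] q₂ ℚ.< M N -[1+ suc c₁ ] q₁
M-neg-< {N} {c₁} {c₂} {q₁} {q₂} h rewrite M-neg N c₁ q₁ | M-neg N c₂ q₂ =
  /-cross-< {a₂ ℤ.- + N} {a₁ ℤ.- + N} ([x-n]*z<[y-n]*w {a₂} {a₁} {+ N} {+ suc c₁} {+ suc c₂}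
    (subst₂ ℤ._<_ (pos-[a*b+c*d] ((2 + c₂) * q₂) (suc c₁) N (suc c₂))
                  (pos-[a*b+c*d] ((2 + c₁) * q₁) (suc c₂) N (suc c₁)) (ℤ.+<+ h)))
  where
  a₁ a₂ : ℤ
  a₁ = + ((2 + c₁) * q₁)
  a₂ = + ((2 + c₂) * q₂)
  pos-[a*b+c*d] : ∀ a b c d → + (a * b + c * d) ≡ + a ℤ.* + b ℤ.+ + c ℤ.* + d
  pos-[a*b+c*d] a b c d = trans (ℤP.pos-+ (a * b) (c * d)) (cong₂ ℤ._+_ (ℤP.pos-* a b) (ℤP.pos-* c d))

Gap2Decreasing : ℕ → (ℕ → ℚ) → Set
Gap2Decreasing m f = ∀ {t₁ t₂} → 1 ≤ t₁ → 2 + t₁ ≤ t₂ → t₂ ≤ m → f t₂ ℚ.< f t₁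

2+2i≤2j : ∀ {i j} → i < j → 2 + 2 * i ≤ 2 * j
2+2i≤2j {i} {j} i<j = subst (_≤ 2 * j) (*-suc 2 i) (*-monoʳ-≤ 2 i<j)

evens-decreasing : ∀ {m f} → Gap2Decreasing m f
  → DecreasingOn (λ j → 1 ≤ 2 * j × 2 * j ≤ m) (λ j → f (2 * j))
evens-decreasing dec i j (1≤2i , _) (_ , 2j≤m) i<j = dec 1≤2i (2+2i≤2j i<j) 2j≤m

odds-decreasing : ∀ {m f} → Gap2Decreasing m f
  → DecreasingOn (λ j → 1 ≤ 2 * j + 1 × 2 * j + 1 ≤ m) (λ j → f (2 * j + 1))
odds-decreasing dec i j (1≤2i+1 , _) (_ , 2j+1≤m) i<j = dec 1≤2i+1 (+-monoˡ-≤ 1 (2+2i≤2j i<j)) 2j+1≤m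

DecreasingOn-cong : ∀ {R a b} → (∀ j → a j ≡ b j) → DecreasingOn R a → DecreasingOn R b
DecreasingOn-cong a≡b dec i j Ri Rj i<j = subst₂ ℚ._<_ (a≡b j) (a≡b i) (dec i j Ri Rj i<j)

t-m-3≡-[3+d] : ∀ {t d m} → t + d ≡ m → + t ℤ.- + m ℤ.- + 3 ≡ -[1+ suc (suc d) ]
t-m-3≡-[3+d] {t} {d} refl = trans (cong (λ x → + t ℤ.- x ℤ.- + 3) (ℤP.pos-+ t d)) (x-[x+y]-3≡-[3+y] (+ t) (+ d))
  where
  x-[x+y]-3≡-[3+y] : ∀ x y → x ℤ.- (x ℤ.+ y) ℤ.- + 3 ≡ ℤ.- (+ 3 ℤ.+ y)
  x-[x+y]-3≡-[3+y] x y = ℤRing.solve (x ∷ y ∷ [])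

n-m-2≡[n+1]-m-3 : ∀ n m → + n ℤ.- + m ℤ.- + 2 ≡ + (n + 1) ℤ.- + m ℤ.- + 3
n-m-2≡[n+1]-m-3 n m = trans (x-y-2≡[x+1]-y-3 (+ n) (+ m)) (cong (λ x → x ℤ.- + m ℤ.- + 3) (sym (ℤP.pos-+ n 1)))
  where
  x-y-2≡[x+1]-y-3 : ∀ x y → x ℤ.- y ℤ.- + 2 ≡ x ℤ.+ + 1 ℤ.- y ℤ.- + 3
  x-y-2≡[x+1]-y-3 x y = ℤRing.solve (x ∷ y ∷ [])

gap-complement : ∀ {t₁ t₂ d₁ d₂ m} → 2 + t₁ ≤ t₂ → t₁ + d₁ ≡ m → t₂ + d₂ ≡ m → 2 + d₂ ≤ d₁
gap-complement {t₁} {t₂} {d₁} {d₂} gap t₁+d₁≡m t₂+d₂≡m = +-cancelˡ-≤ t₁ (2 + d₂) d₁ (begin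
  t₁ + (2 + d₂)  ≡⟨ solve (t₁ ∷ d₂ ∷ []) ⟩
  2 + t₁ + d₂    ≤⟨ +-monoˡ-≤ d₂ gap ⟩
  t₂ + d₂        ≡⟨ trans t₂+d₂≡m (sym t₁+d₁≡m) ⟩
  t₁ + d₁        ∎)
  where open ≤-Reasoning

module _ {m : ℕ} {p : ℕ → ℕ}
  (primes : ∀ i → 1 ≤ i → i ≤ m → Prime (p i))
  (increasing : ∀ i i′ → 1 ≤ i → i < i′ → i′ ≤ m → p i < p i′) where

  private
    N : ℕ
    N = prodPrimes p m

    p≥2 : ∀ i → 1 ≤ i → i ≤ m → 2 ≤ p i
    p≥2 i 1≤i i≤m = ℕ.nonTrivial⇒n>1 (p i) {{prime⇒nonTrivial (primes i 1≤i i≤m)}}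

    p>0 : ∀ {i} → 1 ≤ i → i ≤ m → 0 < p i
    p>0 {i} 1≤i i≤m = ≤-trans (s≤s z≤n) (p≥2 i 1≤i i≤m)

    X*Y*p≤2N : ∀ {t X Y} → 3 ≤ m → 1 ≤ t → t ≤ m → X ≤ m → Y ≤ suc m → X * Y * p t ≤ 2 * N
    X*Y*p≤2N {t} {X} {Y} m≥3 1≤t t≤m X≤m Y≤1+m = begin
      X * Y * p t      ≤⟨ *-monoˡ-≤ (p t) (*-mono-≤ X≤m Y≤1+m) ⟩
      m * suc m * p t  ≤⟨ *-monoˡ-≤ (p t) (n*suc[n]≤2*n! m m≥3) ⟩
      2 * m ! * p t    ≡⟨ *-assoc 2 (m !) (p t) ⟩
      2 * (m ! * p t)  ≡⟨ cong (2 *_) (*-comm (m !) (p t)) ⟩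
      2 * (p t * m !)  ≤⟨ *-monoʳ-≤ 2 (p*!≤prodPrimes (increasing⇒i<p p≥2 increasing) 1≤t t≤m ≤-refl) ⟩
      2 * N            ∎
      where open ≤-Reasoning

  M-pos-decreasing : Gap2Decreasing m (λ t → M N (+ t) (p t))
  M-pos-decreasing {t₁} {t₂} 1≤t₁ gap t₂≤m =
    M-pos-< {N} {t₁} {t₂} {p t₁} {p t₂}
      (cross-<-pos N {q₁ = p t₁} {q₂ = p t₂} 1≤t₁ (p>0 1≤t₁ t₁≤m) gap
        (X*Y*p≤2N (≤-trans 3≤t₂ t₂≤m) (≤-trans (s≤s z≤n) gap) t₂≤m t₂≤m (s≤s t₁≤m)))
    where
    3≤t₂ : 3 ≤ t₂
    3≤t₂ = ≤-trans (s≤s (s≤s 1≤t₁)) gap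
    t₁≤m : t₁ ≤ m
    t₁≤m = ≤-trans (m≤n+m t₁ 2) (≤-trans gap t₂≤m)

  M-neg-decreasing : Gap2Decreasing m (λ t → M N (+ t ℤ.- + m ℤ.- + 3) (p t))
  M-neg-decreasing {t₁} {t₂} 1≤t₁ gap t₂≤m =
    subst₂ (λ k₂ k₁ → M N k₂ (p t₂) ℚ.< M N k₁ (p t₁))
      (sym (t-m-3≡-[3+d] t₂+d₂≡m)) (sym (t-m-3≡-[3+d] t₁+d₁≡m))
      (M-neg-< {N} {suc d₁} {suc d₂} {p t₁} {p t₂}
        (cross-<-neg N {q₁ = p t₁} {q₂ = p t₂} (p>0 1≤t₁ t₁≤m) (s≤s (gap-complement gap t₁+d₁≡m t₂+d₂≡m))
          (X*Y*p≤2N (≤-trans 3≤t₂ t₂≤m) (≤-trans (s≤s z≤n) gap) t₂≤m 3+d₂≤m 2+d₁≤1+m)))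
    where
    t₁≤m : t₁ ≤ m
    t₁≤m = ≤-trans (m≤n+m t₁ 2) (≤-trans gap t₂≤m)
    3≤t₂ : 3 ≤ t₂
    3≤t₂ = ≤-trans (s≤s (s≤s 1≤t₁)) gap
    d₁ d₂ : ℕ
    d₁ = m ∸ t₁
    d₂ = m ∸ t₂
    t₁+d₁≡m : t₁ + d₁ ≡ m
    t₁+d₁≡m = m+[n∸m]≡n t₁≤m
    t₂+d₂≡m : t₂ + d₂ ≡ m
    t₂+d₂≡m = m+[n∸m]≡n t₂≤m
    3+d₂≤m : 3 + d₂ ≤ m
    3+d₂≤m = subst (3 + d₂ ≤_) t₂+d₂≡m (+-monoˡ-≤ d₂ 3≤t₂)
    2+d₁≤1+m : 2 + d₁ ≤ suc m
    2+d₁≤1+m = s≤s (subst (1 + d₁ ≤_) t₁+d₁≡m (+-monoˡ-≤ d₁ 1≤t₁))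

lemma2p4 : (m N : ℕ) (p : ℕ → ℕ) → 2 ≤ m
    → (∀ i → 1 ≤ i → i ≤ m → Prime (p i))
    → (∀ i i′ → 1 ≤ i → i < i′ → i′ ≤ m → p i < p i′)
    → N ≡ prodPrimes p m
    → (DecreasingOn (λ j → 1 ≤ 2 * j × 2 * j ≤ m) (λ j → M N (+ (2 * j)) (p (2 * j)))
       × DecreasingOn (λ j → 1 ≤ 2 * j + 1 × 2 * j + 1 ≤ m) (λ j → M N (+ (2 * j + 1)) (p (2 * j + 1))))
    × (DecreasingOn (λ j → 1 ≤ 2 * j × 2 * j ≤ m) (λ j → M N (+ (2 * j) ℤ.- + m ℤ.- + 3) (p (2 * j)))
       × DecreasingOn (λ j → 1 ≤ 2 * j + 1 × 2 * j + 1 ≤ m) (λ j → M N (+ (2 * j) ℤ.- + m ℤ.- + 2) (p (2 * j + 1))))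
lemma2p4 m N p _ primes increasing refl =
    (evens-decreasing pos , odds-decreasing pos)
  , (evens-decreasing neg , DecreasingOn-cong shift (odds-decreasing neg))
  where
  pos : Gap2Decreasing m (λ t → M N (+ t) (p t))
  pos = M-pos-decreasing primes increasing
  neg : Gap2Decreasing m (λ t → M N (+ t ℤ.- + m ℤ.- + 3) (p t))
  neg = M-neg-decreasing primes increasing
  shift : ∀ j → M N (+ (2 * j + 1) ℤ.- + m ℤ.- + 3) (p (2 * j + 1)) ≡ M N (+ (2 * j) ℤ.- + m ℤ.- + 2) (p (2 * j + 1))
  shift j = cong (λ k → M N k (p (2 * j + 1))) (sym (n-m-2≡[n+1]-m-3 (2 * j) m))
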